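{- Assume the travel times satisfy the triangle inequality $t_{u,v}+t_{v,w}\ge t_{u,w}$ for all $u,v,w\in\{0,\dots,n\}$. Let $0\le i$ and $i+1<j\le n$. If $feasible_a(i,j)$ holds then $feasible_a(i+1,j)$ holds.
   Context: Customers $1,\dots,n$ are in tour order, $0$ is the depot; travel times $t_{u,v}\ge 0$, service times $s_z\ge 0$, time windows $[a_z,b_z]$, day length $T$. For $0\le i<z\le n$ define $A(i,i+1)=\max(t_{0,i+1},a_{i+1})$ and $A(i,z)=\max(A(i,z-1)+s_{z-1}+t_{z-1,z},a_z)$ for $z\ge i+2$ (service start time at customer $z$ for a vehicle leaving the depot and serving $i+1,i+2,\dots$ in order). For $0\le i<j\le n$, $feasible_a(i,j)$ means $A(i,z)\le\min(b_z,\,T-s_z-t_{z,0})$ for all $i<z\le j$.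
   Formalization: The travel times, service times, time windows and day length T all take rational values. -}

module Defs where

open import Data.Nat using (ℕ; zero; suc; _∸_)
import Data.Nat as ℕ
open import Data.Rational using (ℚ; _+_; _-_; _⊔_; _≤_; _⊓_)
open import Data.Product using (_×_)

-- An instance of the routing problem with customers 1..n (in tour order),
-- depot 0. Nodes are represented as natural numbers; only 0..n are relevant.
record Instance : Set where
  field
    n : ℕ
    t : ℕ → ℕ → ℚ
    s : ℕ → ℚ       -- service times
    a : ℕ → ℚ       -- time window opening
    b : ℕ → ℚ       -- time window closing
    T : ℚ           -- day length

open Instance public

-- Aₖ I i k = A(i, i+1+k): service start time at customer i+1+k
-- for a vehicle leaving the depot and serving i+1, i+2, … in order.
Aₖ : Instance → ℕ → ℕ → ℚ
Aₖ I i zero    = t I 0 (suc i) ⊔ a I (suc i)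
Aₖ I i (suc k) =
  ((Aₖ I i k + s I (suc i ℕ.+ k)) + t I (suc i ℕ.+ k) (suc (suc i ℕ.+ k)))
    ⊔ a I (suc (suc i ℕ.+ k))

-- A(i,z) for i < z  (z = i + 1 + (z ∸ (i+1)))
A : Instance → ℕ → ℕ → ℚ
A I i z = Aₖ I i (z ∸ suc i)

feasibleA : Instance → ℕ → ℕ → Set
feasibleA I i j = ∀ z → i ℕ.< z → z ℕ.≤ j →
  A I i z ≤ (b I z ⊓ ((T I - s I z) - t I z 0))

-- Leaving the depot for customer i+2 directly is no slower than the detour via
-- i+1 (triangle inequality, nonnegative service time), and every later start
-- time is a monotone function of the previous one. So the route starting at
-- i+1 serves each customer no later than the route starting at i, and each
-- deadline met by the longer route is met by the shorter one.
module Submission where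

open import Defs
open import Data.Nat using (ℕ; zero; suc; _∸_)
import Data.Nat as ℕ
import Data.Nat.Properties as ℕ
open import Data.Rational using (0ℚ; _+_; _≤_; _⊔_)
open import Data.Rational.Properties
open import Relation.Binary.PropositionalEquality using (_≡_; refl; subst)

p≤p+q : ∀ p {q} → 0ℚ ≤ q → p ≤ p + q
p≤p+q p 0≤q = subst (_≤ p + _) (+-identityʳ p) (+-monoʳ-≤ p 0≤q)

∸-suc-offset : ∀ i z → suc i ℕ.< z → z ∸ suc i ≡ suc (z ∸ suc (suc i))
∸-suc-offset zero    (suc zero)    (ℕ.s≤s ())
∸-suc-offset zero    (suc (suc z)) _          = refl
∸-suc-offset (suc i) (suc z)       (ℕ.s≤s i<z) = ∸-suc-offset i z i<z

module _ (I : Instance) where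

  Aₖ-shift-mono : ∀ i → Aₖ I (suc i) 0 ≤ Aₖ I i 1 →
                  ∀ k → Aₖ I (suc i) k ≤ Aₖ I i (suc k)
  Aₖ-shift-mono i first zero    = first
  Aₖ-shift-mono i first (suc k) rewrite ℕ.+-suc (suc i) k =
    ⊔-monoˡ-≤ _ (+-monoˡ-≤ _ (+-monoˡ-≤ _ (Aₖ-shift-mono i first k)))

  Aₖ-first-shift : ∀ i → 0ℚ ≤ s I (suc i) →
                   t I 0 (suc (suc i)) ≤ t I 0 (suc i) + t I (suc i) (suc (suc i)) →
                   Aₖ I (suc i) 0 ≤ Aₖ I i 1
  Aₖ-first-shift i 0≤s triangle rewrite ℕ.+-identityʳ i =
    ⊔-monoˡ-≤ _ (≤-trans triangle (+-monoˡ-≤ _ (begin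
      t I 0 (suc i)                  ≤⟨ p≤p⊔q _ _ ⟩
      Aₖ I i 0                       ≤⟨ p≤p+q _ 0≤s ⟩
      Aₖ I i 0 + s I (suc i)         ∎)))
    where open ≤-Reasoning

mainTheorem5 : (I : Instance) →
    (∀ u v → u ℕ.≤ n I → v ℕ.≤ n I → 0ℚ ≤ t I u v) →
    (∀ z → z ℕ.≤ n I → 0ℚ ≤ s I z) →
    (∀ u v w → u ℕ.≤ n I → v ℕ.≤ n I → w ℕ.≤ n I →
    t I u w ≤ t I u v + t I v w) →
    (i j : ℕ) → suc i ℕ.< j → j ℕ.≤ n I →
    feasibleA I i j → feasibleA I (suc i) j
mainTheorem5 I _ s≥0 triangle i j i+1<j j≤n feasible z i+1<z z≤j =
  ≤-trans A-later-start (feasible z (ℕ.<-trans (ℕ.n<1+n i) i+1<z) z≤j)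
  where
  i+2≤n : suc (suc i) ℕ.≤ n I
  i+2≤n = ℕ.≤-trans i+1<j j≤n

  i+1≤n : suc i ℕ.≤ n I
  i+1≤n = ℕ.≤-trans (ℕ.n≤1+n (suc i)) i+2≤n

  A-later-start : A I (suc i) z ≤ A I i z
  A-later-start rewrite ∸-suc-offset i z i+1<z =
    Aₖ-shift-mono I i
      (Aₖ-first-shift I i (s≥0 (suc i) i+1≤n)
        (triangle 0 (suc i) (suc (suc i)) ℕ.z≤n i+1≤n i+2≤n))
      (z ∸ suc (suc i))
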